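{- Let $h\geq 1$ and let $\vec c=[c_1,\ldots,c_h]$ be a color sequence. If the Color-Splitting Algorithm run on $(h,\vec c)$ terminates successfully, then the coloring of the non-root nodes of $T(h)$ it produces is an ancestral coloring, i.e. no node receives the same color as any of its ancestors.
   Context: $T(h)$ is the perfect binary tree with nodes $1,\ldots,2^{h+1}-1$, root $1$ (colorless), and children $2R,2R+1$ of node $R$. A color sequence is a non-decreasing list of positive integers. A labeled sequence of dimension $d$ is a list of pairs $(\kappa_1,c_1),\ldots,(\kappa_d,c_d)$ of distinct color labels $\kappa_j$ and integer counts with $c_1\leq\cdots\leq c_d$. Procedure Split$(d,\vec c)$ (for $d\geq2$) returns two labeled sequences of dimension $d-1$: Case 1, $c_1=2$: $a_2=\lfloor c_2/2\rfloor$, $b_2=\lceil c_2/2\rceil$, and for $i=3,\ldots,d$, if $\sum_{j=2}^{i-1}a_j<\sum_{j=2}^{i-1}b_j$ then $a_i=\lceil c_i/2\rceil,b_i=\lfloor c_i/2\rfloor$, else $a_i=\lfloor c_i/2\rfloor,b_i=\lceil c_i/2\rceil$; $a_i,b_i$ carry label $\kappa_i$. Case 2, $c_1>2$: $a_2=c_2-1$ with label $\kappa_2$, $b_2=c_1-1$ with label $\kappa_1$; if $d\geq3$, $a_3=\lceil (c_3+c_1-c_2)/2\rceil$ and $b_3=c_2-c_1+\lfloor (c_3+c_1-c_2)/2\rfloor$ with label $\kappa_3$, and for $i=4,\ldots,d$ the same alternating rule as in Case 1 with label $\kappa_i$. Finally both lists are sorted by count in non-decreasing order. Procedure Rec$(R,d,\vec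 c)$: if $d\geq1$, let $A=2R$, $B=2R+1$; if $c_1=2$ assign color $\kappa_1$ to both $A$ and $B$, otherwise assign $\kappa_1$ to $A$ and $\kappa_2$ to $B$; if $d\geq2$, let $(\vec a,\vec b)=$Split$(d,\vec c)$ and call Rec$(A,d-1,\vec a)$ and Rec$(B,d-1,\vec b)$. The Color-Splitting Algorithm on $(h,\vec c)$ labels $c_i$ with color $i$ and calls Rec$(1,h,\vec c)$. It terminates successfully if in every call Rec$(R,d,\vec c)$ with $d\geq1$ all counts are positive and $c_1\geq 2$ (so that all steps are well defined). -}

module Defs where

open import Data.Nat using (ℕ; zero; suc; _+_; _*_; _∸_; _≤_; _≤ᵇ_; _<ᵇ_; _≡ᵇ_; ⌊_/2⌋; ⌈_/2⌉)
open import Data.Bool using (Bool; true; false; if_then_else_; _∧_)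
open import Data.List using (List; []; _∷_; foldr; _++_)
open import Data.Product using (_×_; _,_; proj₁; proj₂)
open import Data.Maybe using (Maybe; just; nothing)
open import Relation.Binary.PropositionalEquality using (_≡_)
open import Data.Sum using (_⊎_)

-- A labeled sequence: list of (color label κ , count c).
LSeq : Set
LSeq = List (ℕ × ℕ)

insertC : ℕ × ℕ → LSeq → LSeq
insertC p [] = p ∷ []
insertC p (q ∷ qs) = if proj₂ p ≤ᵇ proj₂ q then p ∷ q ∷ qs else q ∷ insertC p qs

sortC : LSeq → LSeq
sortC = foldr insertC []

-- Alternating rule for indices i onward; sa, sb are the running sums
-- Σ_{j=2}^{i-1} a_j and Σ_{j=2}^{i-1} b_j.
alt : ℕ → ℕ → LSeq → LSeq × LSeq
alt sa sb [] = [] , []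
alt sa sb ((κ , c) ∷ r) =
  let ai = if sa <ᵇ sb then ⌈ c /2⌉ else ⌊ c /2⌋
      bi = if sa <ᵇ sb then ⌊ c /2⌋ else ⌈ c /2⌉
      rest = alt (sa + ai) (sb + bi) r
  in ((κ , ai) ∷ proj₁ rest) , ((κ , bi) ∷ proj₂ rest)

-- Procedure Split (before the final sort); meaningful for d ≥ 2.
splitRaw : LSeq → LSeq × LSeq
splitRaw ((κ₁ , c₁) ∷ (κ₂ , c₂) ∷ r) =
  if c₁ ≡ᵇ 2
  then (let a₂ = ⌊ c₂ /2⌋
            b₂ = ⌈ c₂ /2⌉
            rest = alt a₂ b₂ r
        in ((κ₂ , a₂) ∷ proj₁ rest) , ((κ₂ , b₂) ∷ proj₂ rest))
  else case2 r
  where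
  a₂ = c₂ ∸ 1
  b₂ = c₁ ∸ 1
  case2 : LSeq → LSeq × LSeq
  case2 [] = ((κ₂ , a₂) ∷ []) , ((κ₁ , b₂) ∷ [])
  case2 ((κ₃ , c₃) ∷ r') =
    let a₃ = ⌈ (c₃ + c₁ ∸ c₂) /2⌉
        b₃ = (c₂ ∸ c₁) + ⌊ (c₃ + c₁ ∸ c₂) /2⌋
        rest = alt (a₂ + a₃) (b₂ + b₃) r'
    in ((κ₂ , a₂) ∷ (κ₃ , a₃) ∷ proj₁ rest) , ((κ₁ , b₂) ∷ (κ₃ , b₃) ∷ proj₂ rest)
splitRaw _ = [] , []

split : LSeq → LSeq × LSeq
split c = sortC (proj₁ (splitRaw c)) , sortC (proj₂ (splitRaw c))

-- A coloring is a list of assignments (node , color).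
Coloring : Set
Coloring = List (ℕ × ℕ)

_>>=_ : {A B : Set} → Maybe A → (A → Maybe B) → Maybe B
just x >>= f = f x
nothing >>= f = nothing

allPos : LSeq → Bool
allPos [] = true
allPos ((_ , c) ∷ r) = (1 ≤ᵇ c) ∧ allPos r

assign : ℕ → ℕ → LSeq → Maybe Coloring
assign A B [] = nothing
assign A B ((κ₁ , c₁) ∷ r) = if c₁ ≡ᵇ 2 then just ((A , κ₁) ∷ (B , κ₁) ∷ []) else second r
  where
  second : LSeq → Maybe Coloring
  second [] = nothing
  second ((κ₂ , _) ∷ _) = just ((A , κ₁) ∷ (B , κ₂) ∷ [])

-- Rec(R, d, c): returns nothing if some step is ill-defined, i.e. in some call
-- with d ≥ 1 a count is non-positive, c₁ < 2, or c₁ > 2 but κ₂ does not exist.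
rec : ℕ → ℕ → LSeq → Maybe Coloring
rec zero R c = just []
rec (suc d) R [] = nothing
rec (suc d) R ((κ₁ , c₁) ∷ r) =
  if allPos ((κ₁ , c₁) ∷ r) ∧ (2 ≤ᵇ c₁)
  then (here >>= λ col →
          children d >>= λ rest → just (col ++ rest))
  else nothing
  where
  A = 2 * R
  B = suc (2 * R)
  here : Maybe Coloring
  here = assign A B ((κ₁ , c₁) ∷ r)
  children : ℕ → Maybe Coloring
  children zero = just []
  children (suc _) =
    rec d A (proj₁ (split ((κ₁ , c₁) ∷ r))) >>= λ ca →
    rec d B (proj₂ (split ((κ₁ , c₁) ∷ r))) >>= λ cb →
    just (ca ++ cb)

labelFrom : ℕ → List ℕ → LSeq
labelFrom i [] = []
labelFrom i (x ∷ xs) = (i , x) ∷ labelFrom (suc i) xs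

-- The Color-Splitting Algorithm on (h, c); just col iff it terminates successfully.
colorSplitting : ℕ → List ℕ → Maybe Coloring
colorSplitting h c = rec h 1 (labelFrom 1 c)

Child : ℕ → ℕ → Set
Child u v = (v ≡ 2 * u) ⊎ (v ≡ suc (2 * u))

data Ancestor (u : ℕ) : ℕ → Set where
  parent : ∀ {v} → Child u v → Ancestor u v
  step   : ∀ {w v} → Ancestor u w → Child w v → Ancestor u v

{-# OPTIONS --safe #-}
-- Number the nodes heap-style, so that the ancestors of v are its iterated halvings.  So, by
-- induction on the depth, a subtree is coloured from the labels of its sequence only, a
-- child's colour never reappears below it, and the two sibling subtrees are disjoint, so no
-- ancestor pair crosses between them.
module Submission where

open import Defs
open import Data.Bool using (true; false; if_then_else_)
open import Data.Empty using (⊥)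
open import Data.List using (List; []; _∷_; _++_; map; length)
open import Data.List.Membership.Propositional using (_∈_; _∉_)
open import Data.List.Membership.Propositional.Properties using (∈-++⁻)
open import Data.List.Relation.Binary.Permutation.Propositional
  using (_↭_; prep; swap; ↭-refl; ↭-sym; ↭-trans; ↭⇒↭ₛ)
open import Data.List.Relation.Binary.Permutation.Propositional.Properties
  using (∈-resp-↭; map⁺; shift)
open import Data.List.Relation.Binary.Permutation.Setoid.Properties
  using (Unique-resp-↭)
open import Data.List.Relation.Unary.AllPairs as AllPairs using (_∷_)
open import Data.List.Relation.Unary.All using (All)
open import Data.List.Relation.Unary.Any using (here; there)
open import Data.List.Relation.Unary.Linked using (Linked; []; [-]; _∷_)
open import Data.List.Relation.Unary.Linked.Properties using (Linked⇒AllPairs)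
open import Data.List.Relation.Unary.Unique.Propositional using (Unique)
open import Data.List.Relation.Unary.Unique.Propositional.Properties using (Unique[x∷xs]⇒x∉xs)
open import Data.Maybe using (Maybe; just; nothing)
open import Data.Maybe.Properties using (just-injective)
open import Data.Nat using (ℕ; zero; suc; _+_; _*_; _≤_; _<_; _≤ᵇ_; _≡ᵇ_; ⌊_/2⌋; z≤n; s≤s)
open import Data.Nat.Properties
  using (≤-refl; ≤-reflexive; ≤-trans; ≤-<-trans; <-≤-trans; <-trans; <-irrefl; <⇒≤; <⇒≢;
         1+n≰n; m≤m+n; m<m+n; +-identityʳ; ⌊n/2⌋≤n; ⌊n/2⌋<n; n≡⌊n+n/2⌋; n≡⌈n+n/2⌉)
open import Data.Product using (_×_; _,_; proj₁; proj₂; ∃-syntax; ∃₂)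
open import Data.Sum using (_⊎_; inj₁; inj₂)
open import Relation.Binary.PropositionalEquality
  using (_≡_; _≢_; refl; sym; trans; cong; subst; setoid)
open import Relation.Nullary using (¬_)

private
  variable
    u v w x y A R κ κA κB : ℕ
    L La Lb : List ℕ
    col ca cb : Coloring

⌊_/2^_⌋ : ℕ → ℕ → ℕ
⌊ v /2^ zero ⌋  = v
⌊ v /2^ suc k ⌋ = ⌊ ⌊ v /2⌋ /2^ k ⌋

infix 4 _≼_ _≺_

_≼_ : ℕ → ℕ → Set
u ≼ v = ∃[ k ] ⌊ v /2^ k ⌋ ≡ u

_≺_ : ℕ → ℕ → Set
u ≺ v = u ≼ ⌊ v /2⌋

⌊/2^⌋-+ : ∀ m n v → ⌊ v /2^ (m + n) ⌋ ≡ ⌊ ⌊ v /2^ m ⌋ /2^ n ⌋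
⌊/2^⌋-+ zero    n v = refl
⌊/2^⌋-+ (suc m) n v = ⌊/2^⌋-+ m n ⌊ v /2⌋

≼-trans : u ≼ v → v ≼ w → u ≼ w
≼-trans (i , refl) (j , refl) = j + i , ⌊/2^⌋-+ j i _

≺⇒≼ : u ≺ v → u ≼ v
≺⇒≼ u≺v = ≼-trans u≺v (1 , refl)

≺-trans : u ≺ v → v ≺ w → u ≺ w
≺-trans u≺v = ≼-trans (≺⇒≼ u≺v)

≺-≼-trans : u ≺ v → v ≼ w → u ≺ w
≺-≼-trans u≺v (zero  , refl) = u≺v
≺-≼-trans u≺v (suc k , refl) = ≺-trans u≺v (k , refl)

≼⇒≤ : u ≼ v → u ≤ v
≼⇒≤ (zero  , refl) = ≤-refl
≼⇒≤ (suc k , refl) = ≤-trans (≼⇒≤ (k , refl)) (⌊n/2⌋≤n _)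

≺⇒< : 1 ≤ v → u ≺ v → u < v
≺⇒< {suc v} _ u≺v = ≤-<-trans (≼⇒≤ u≺v) (⌊n/2⌋<n v)

≺-irrefl : 1 ≤ v → ¬ v ≺ v
≺-irrefl 1≤v v≺v = <⇒≢ (≺⇒< 1≤v v≺v) refl

⌊/2^⌋-comparable : ∀ i j v → ⌊ v /2^ i ⌋ ≼ ⌊ v /2^ j ⌋ ⊎ ⌊ v /2^ j ⌋ ≼ ⌊ v /2^ i ⌋
⌊/2^⌋-comparable zero    j       v = inj₂ (j , refl)
⌊/2^⌋-comparable (suc i) zero    v = inj₁ (suc i , refl)
⌊/2^⌋-comparable (suc i) (suc j) v = ⌊/2^⌋-comparable i j ⌊ v /2⌋

≼-comparable : u ≼ w → v ≼ w → u ≼ v ⊎ v ≼ u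
≼-comparable (i , refl) (j , refl) = ⌊/2^⌋-comparable i j _

⌊2n/2⌋≡n : ∀ n → ⌊ 2 * n /2⌋ ≡ n
⌊2n/2⌋≡n n rewrite +-identityʳ n = sym (n≡⌊n+n/2⌋ n)

⌊1+2n/2⌋≡n : ∀ n → ⌊ suc (2 * n) /2⌋ ≡ n
⌊1+2n/2⌋≡n n rewrite +-identityʳ n = sym (n≡⌈n+n/2⌉ n)

Child⇒≺ : Child u v → u ≺ v
Child⇒≺ {u} (inj₁ refl) = zero , ⌊2n/2⌋≡n u
Child⇒≺ {u} (inj₂ refl) = zero , ⌊1+2n/2⌋≡n u

Ancestor⇒≺ : Ancestor u v → u ≺ v
Ancestor⇒≺ (parent ch)  = Child⇒≺ ch
Ancestor⇒≺ (step a ch) = ≺-trans (Ancestor⇒≺ a) (Child⇒≺ ch)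

n<2n : 1 ≤ R → R < 2 * R
n<2n {R = R} 1≤R = m<m+n R (≤-trans 1≤R (m≤m+n R 0))

1≤2n : 1 ≤ R → 1 ≤ 2 * R
1≤2n 1≤R = ≤-trans 1≤R (<⇒≤ (n<2n 1≤R))

siblings-disjoint : 1 ≤ R → 2 * R ≼ w → suc (2 * R) ≼ w → ⊥
siblings-disjoint {R = R} 1≤R A≼w B≼w with ≼-comparable A≼w B≼w
... | inj₂ B≼A          = 1+n≰n (≼⇒≤ B≼A)
... | inj₁ (zero , B≡A)  = 1+n≰n (≤-reflexive B≡A)
... | inj₁ (suc k , e)    =
  <-irrefl refl (<-≤-trans (n<2n 1≤R) (≼⇒≤ (subst (2 * R ≼_) (⌊1+2n/2⌋≡n R) (k , e))))

Ancestral : Coloring → Set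
Ancestral col = ∀ {u v κ κ′} → (u , κ) ∈ col → (v , κ′) ∈ col → u ≺ v → κ ≢ κ′

Within : (ℕ → Set) → List ℕ → Coloring → Set
Within P L col = ∀ {v κ} → (v , κ) ∈ col → P v × κ ∈ L

ancestral-↭ : col ↭ ca → Ancestral ca → Ancestral col
ancestral-↭ p anc u∈ v∈ = anc (∈-resp-↭ p u∈) (∈-resp-↭ p v∈)

within-↭ : ∀ {P} → col ↭ ca → Within P L ca → Within P L col
within-↭ p within v∈ = within (∈-resp-↭ p v∈)

within-++ : ∀ {P} → Within P L ca → Within P L cb → Within P L (ca ++ cb)
within-++ {ca = ca} withinA withinB v∈ with ∈-++⁻ ca v∈
... | inj₁ v∈a = withinA v∈a
... | inj₂ v∈b = withinB v∈b

within-mono : ∀ {P Q L′} → (∀ {v} → P v → Q v) → (∀ {κ} → κ ∈ L → κ ∈ L′) →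
              Within P L col → Within Q L′ col
within-mono P⇒Q L⊆L′ within v∈ with within v∈
... | Pv , κ∈L = P⇒Q Pv , L⊆L′ κ∈L

within-cons : Within (A ≺_) L col → Within (A ≼_) (κ ∷ L) ((A , κ) ∷ col)
within-cons within (here refl) = (zero , refl) , here refl
within-cons within (there v∈)  = ≺⇒≼ (proj₁ (within v∈)) , there (proj₂ (within v∈))

ancestral-cons : 1 ≤ A → κ ∉ L → Within (A ≺_) L col → Ancestral col →
                 Ancestral ((A , κ) ∷ col)
ancestral-cons 1≤A κ∉L within anc (here refl) (here refl) A≺A _   = ≺-irrefl 1≤A A≺A
ancestral-cons 1≤A κ∉L within anc (here refl) (there v∈)  _ refl  = κ∉L (proj₂ (within v∈))
ancestral-cons 1≤A κ∉L within anc (there u∈)  (here refl) u≺A _  =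
  ≺-irrefl 1≤A (≺-trans (proj₁ (within u∈)) u≺A)
ancestral-cons 1≤A κ∉L within anc (there u∈)  (there v∈)  u≺v    = anc u∈ v∈ u≺v

ancestral-++ : (∀ {w} → x ≼ w → y ≼ w → ⊥) →
               Within (x ≼_) La ca → Within (y ≼_) Lb cb →
               Ancestral ca → Ancestral cb → Ancestral (ca ++ cb)
ancestral-++ {ca = ca} disjoint withinA withinB ancA ancB u∈ v∈ u≺v
  with ∈-++⁻ ca u∈ | ∈-++⁻ ca v∈
... | inj₁ u∈a | inj₁ v∈a = ancA u∈a v∈a u≺v
... | inj₂ u∈b | inj₂ v∈b = ancB u∈b v∈b u≺v
... | inj₁ u∈a | inj₂ v∈b = λ _ →
  disjoint (≼-trans (proj₁ (withinA u∈a)) (≺⇒≼ u≺v)) (proj₁ (withinB v∈b))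
... | inj₂ u∈b | inj₁ v∈a = λ _ →
  disjoint (proj₁ (withinA v∈a)) (≼-trans (proj₁ (withinB u∈b)) (≺⇒≼ u≺v))

ancestral-children : 1 ≤ R → L ↭ κA ∷ La → L ↭ κB ∷ Lb → κA ∉ La → κB ∉ Lb →
  Ancestral ca → Within (2 * R ≺_) La ca → Ancestral cb → Within (suc (2 * R) ≺_) Lb cb →
  let col = (2 * R , κA) ∷ (suc (2 * R) , κB) ∷ ca ++ cb in Ancestral col × Within (R ≺_) L col
ancestral-children {R = R} {κA = κA} {κB = κB} {ca = ca} {cb = cb}
                   1≤R pA pB κA∉La κB∉Lb ancA withinA ancB withinB =
  ancestral-↭ regroup
    (ancestral-++ (siblings-disjoint 1≤R) (within-cons withinA) (within-cons withinB)
      (ancestral-cons (1≤2n 1≤R) κA∉La withinA ancA)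
      (ancestral-cons (s≤s z≤n) κB∉Lb withinB ancB)) ,
  within-↭ regroup
    (within-++
      (within-mono (≺-≼-trans (Child⇒≺ (inj₁ refl))) (∈-resp-↭ (↭-sym pA)) (within-cons withinA))
      (within-mono (≺-≼-trans (Child⇒≺ (inj₂ refl))) (∈-resp-↭ (↭-sym pB)) (within-cons withinB)))
  where
  regroup : (2 * R , κA) ∷ (suc (2 * R) , κB) ∷ ca ++ cb
          ↭ ((2 * R , κA) ∷ ca) ++ ((suc (2 * R) , κB) ∷ cb)
  regroup = prep _ (↭-sym (shift _ ca cb))

labels : LSeq → List ℕ
labels = map proj₁

insertC-↭ : ∀ p xs → insertC p xs ↭ p ∷ xs
insertC-↭ p []       = ↭-refl
insertC-↭ p (q ∷ qs) with proj₂ p ≤ᵇ proj₂ q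
... | true  = ↭-refl
... | false = ↭-trans (prep q (insertC-↭ p qs)) (swap q p ↭-refl)

sortC-↭ : ∀ xs → sortC xs ↭ xs
sortC-↭ []       = ↭-refl
sortC-↭ (x ∷ xs) = ↭-trans (insertC-↭ x (sortC xs)) (prep x (sortC-↭ xs))

↭-labels-sortC : ∀ xs → labels xs ≡ L → L ↭ labels (sortC xs)
↭-labels-sortC xs refl = ↭-sym (map⁺ proj₁ (sortC-↭ xs))

labels-alt : ∀ sa sb r →
  labels (proj₁ (alt sa sb r)) ≡ labels r × labels (proj₂ (alt sa sb r)) ≡ labels r
labels-alt sa sb []            = refl , refl
labels-alt sa sb ((κ , c) ∷ r) =
  cong (κ ∷_) (proj₁ (labels-alt _ _ r)) , cong (κ ∷_) (proj₂ (labels-alt _ _ r))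

assign-split : ∀ A B c {h} → assign A B c ≡ just h →
  ∃₂ λ κA κB → h ≡ (A , κA) ∷ (B , κB) ∷ [] ×
    labels c ↭ κA ∷ labels (proj₁ (split c)) × labels c ↭ κB ∷ labels (proj₂ (split c))
assign-split A B [] ()
assign-split A B ((κ₁ , c₁) ∷ []) eq with c₁ ≡ᵇ 2
assign-split A B ((κ₁ , c₁) ∷ []) refl | true  = κ₁ , κ₁ , refl , ↭-refl , ↭-refl
assign-split A B ((κ₁ , c₁) ∷ []) ()   | false
assign-split A B ((κ₁ , c₁) ∷ (κ₂ , c₂) ∷ r) eq with c₁ ≡ᵇ 2
assign-split A B ((κ₁ , c₁) ∷ (κ₂ , c₂) ∷ r) refl | true =
  κ₁ , κ₁ , refl ,
  prep κ₁ (↭-labels-sortC _ (cong (κ₂ ∷_) (proj₁ (labels-alt _ _ r)))) ,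
  prep κ₁ (↭-labels-sortC _ (cong (κ₂ ∷_) (proj₂ (labels-alt _ _ r))))
assign-split A B ((κ₁ , c₁) ∷ (κ₂ , c₂) ∷ []) refl | false =
  κ₁ , κ₂ , refl , ↭-refl , swap κ₁ κ₂ ↭-refl
assign-split A B ((κ₁ , c₁) ∷ (κ₂ , c₂) ∷ (κ₃ , c₃) ∷ r) refl | false =
  κ₁ , κ₂ , refl ,
  prep κ₁ (↭-labels-sortC _ (cong (λ t → κ₂ ∷ κ₃ ∷ t) (proj₁ (labels-alt _ _ r)))) ,
  ↭-trans (swap κ₁ κ₂ ↭-refl)
          (prep κ₂ (↭-labels-sortC _ (cong (λ t → κ₁ ∷ κ₃ ∷ t) (proj₂ (labels-alt _ _ r)))))

if-just : ∀ {X : Set} b {m : Maybe X} {x} → (if b then m else nothing) ≡ just x → m ≡ just x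
if-just true eq = eq

>>=-just : ∀ {X Y : Set} (m : Maybe X) {f : X → Maybe Y} {y} →
           (m >>= f) ≡ just y → ∃[ x ] m ≡ just x × f x ≡ just y
>>=-just (just x) eq = x , refl , eq

rec-suc-inversion : ∀ d R c {col} → rec (suc d) R c ≡ just col →
  ∃[ h ] ∃₂ λ ca cb → assign (2 * R) (suc (2 * R)) c ≡ just h ×
    rec d (2 * R) (proj₁ (split c)) ≡ just ca × rec d (suc (2 * R)) (proj₂ (split c)) ≡ just cb ×
    col ≡ h ++ ca ++ cb
rec-suc-inversion zero R ((κ₁ , c₁) ∷ r) eq
  with h , eqh , eq₁ ← >>=-just _ (if-just _ eq)
  = h , [] , [] , eqh , refl , refl , sym (just-injective eq₁)
rec-suc-inversion (suc d) R ((κ₁ , c₁) ∷ r) eq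
  with h , eqh , eq₁ ← >>=-just _ (if-just _ eq)
  with rest , eq₂ , eq₃ ← >>=-just _ eq₁
  with ca , eqa , eq₄ ← >>=-just _ eq₂
  with cb , eqb , eq₅ ← >>=-just _ eq₄
  = h , ca , cb , eqh , eqa , eqb ,
    trans (sym (just-injective eq₃)) (cong (h ++_) (sym (just-injective eq₅)))

unique-resp : L ↭ La → Unique L → Unique La
unique-resp p = Unique-resp-↭ (setoid ℕ) (↭⇒↭ₛ p)

unique-child : Unique L → L ↭ κ ∷ La → κ ∉ La × Unique La
unique-child uniq p with unique-resp p uniq
... | uniq′@(_ ∷ uniqLa) = Unique[x∷xs]⇒x∉xs uniq′ , uniqLa

rec-ancestral : ∀ d R c {col} → 1 ≤ R → Unique (labels c) → rec d R c ≡ just col →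
                Ancestral col × Within (R ≺_) (labels c) col
rec-ancestral zero    R c 1≤R uniq refl = (λ ()) , (λ ())
rec-ancestral (suc d) R c 1≤R uniq eq
  with h , ca , cb , eqh , eqa , eqb , refl ← rec-suc-inversion d R c eq
  with κA , κB , refl , pA , pB ← assign-split (2 * R) (suc (2 * R)) c eqh
  with κA∉La , uniqA ← unique-child uniq pA
  with κB∉Lb , uniqB ← unique-child uniq pB
  with ancA , withinA ← rec-ancestral d (2 * R) _ (1≤2n 1≤R) uniqA eqa
  with ancB , withinB ← rec-ancestral d (suc (2 * R)) _ (s≤s z≤n) uniqB eqb
  = ancestral-children 1≤R pA pB κA∉La κB∉Lb ancA withinA ancB withinB

labelFrom-increasing : ∀ i xs → Linked _<_ (labels (labelFrom i xs))
labelFrom-increasing i []           = []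
labelFrom-increasing i (x ∷ [])     = [-]
labelFrom-increasing i (x ∷ y ∷ xs) = ≤-refl ∷ labelFrom-increasing (suc i) (y ∷ xs)

labelFrom-unique : ∀ i xs → Unique (labels (labelFrom i xs))
labelFrom-unique i xs = AllPairs.map <⇒≢ (Linked⇒AllPairs <-trans (labelFrom-increasing i xs))

lemma2 : (h : ℕ) (c : List ℕ) → 1 ≤ h → length c ≡ h → All (1 ≤_) c → Linked _≤_ c →
    (col : Coloring) → colorSplitting h c ≡ just col →
    ∀ {u v κ κ′} → (u , κ) ∈ col → (v , κ′) ∈ col → Ancestor u v → κ ≢ κ′
lemma2 h c _ _ _ _ col eq u∈ v∈ u-anc-v =
  proj₁ (rec-ancestral h 1 (labelFrom 1 c) (s≤s z≤n) (labelFrom-unique 1 c) eq) u∈ v∈ (Ancestor⇒≺ u-anc-v)
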